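{- Let $\Gamma$ be a flat disunification problem as in the context and $\tau$ a propositional valuation satisfying all clauses of $\mathsf{Cl}(\Gamma)$. Define the assignment $S^\tau$ by $S^\tau_X=\{D\in\mathsf{At_{nv}}\mid \tau([X\sqsubseteq D])=1\}$ for $X\in N_v$. Then the relation $>_{S^\tau}$ is irreflexive.
   Context: $\mathcal{EL}$ concept terms are built from concept names $N_C$ (partitioned into variables $N_v$ and constants $N_c$) and role names $N_R$ by $C ::= A \mid \top \mid C\sqcap D \mid \exists r.C$. An atom is a concept name or existential restriction; a flat atom is a concept name or $\exists r.A$ with $A\in N_C$. $\Gamma$ is a flat disunification problem: a finite set of subsumptions $C_1\sqcap\dots\sqcap C_n\sqsubseteq^?D$ ($n\ge0$, flat atoms) and dissubsumptions, where every dissubsumption has the form $X\not\sqsubseteq^?Y$ with $X,Y$ variables. $N_v,N_c,N_R$ consist exactly of the variables, constants and role names occurring in $\Gamma$. $\mathsf{At}$ is the set of atoms occurring as subterms of $\Gamma$, $\mathsf{At_{nv}}=\mathsf{At}\setminus N_v$. For an assignment $S$ ($S_X\subseteq\mathsf{At_{nv}}$ for $X\in N_v$), $>_S$ is the transitive closure of $\{(X,Y)\mid Y$ occurs in an atom of $S_X\}$. $\mathsf{Cl}(\Gamma)$ is the set of propositional clauses over variables $[C\sqsubseteq D]$ ($C,D\in\mathsf{At}$), $[X>Y]$ ($X,Y\in N_v$), $p_{C,X,D}$ ($C\in\mathsf{At}$, $X\in N_v$, $D\in\mathsf{At_{nv}}$), consisting of: (Ia) for each $C_1\sqcap\dots\sqcap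 C_n\sqsubseteq^?D$ in $\Gamma$ with $D\in\mathsf{At_{nv}}$: $[C_1\sqsubseteq D]\vee\dots\vee[C_n\sqsubseteq D]$; (Ib) for each $C_1\sqcap\dots\sqcap C_n\sqsubseteq^?X$ in $\Gamma$ with $X\in N_v$ and each $E\in\mathsf{At_{nv}}$: $\neg[X\sqsubseteq E]\vee[C_1\sqsubseteq E]\vee\dots\vee[C_n\sqsubseteq E]$; (Ic) for each $X\not\sqsubseteq^?Y$ in $\Gamma$: $\neg[X\sqsubseteq Y]$; (IIa) for $A\in N_c$: $[A\sqsubseteq A]$; (IIb) for $A\neq B\in N_c$: $\neg[A\sqsubseteq B]$; (IIc) for $\exists r.A,\exists s.B\in\mathsf{At_{nv}}$, $r\neq s$: $\neg[\exists r.A\sqsubseteq\exists s.B]$; (IId) for $A\in N_c$, $\exists r.B\in\mathsf{At_{nv}}$: $\neg[A\sqsubseteq\exists r.B]$ and $\neg[\exists r.B\sqsubseteq A]$; (IIe) for $\exists r.A,\exists r.B\in\mathsf{At_{nv}}$: $\neg[\exists r.A\sqsubseteq\exists r.B]\vee[A\sqsubseteq B]$ and $\neg[A\sqsubseteq B]\vee[\exists r.A\sqsubseteq\exists r.B]$; (III) for $C_1,C_2,C_3\in\mathsf{At}$: $\neg[C_1\sqsubseteq C_2]\vee\neg[C_2\sqsubseteq C_3]\vee[C_1\sqsubseteq C_3]$; (IV) for $C\in\mathsf{At}$, $X\in N_v$: $[C\sqsubseteq X]\vee\bigvee_{D\in\mathsf{At_{nv}}}p_{C,X,D}$, and for each $D\in\mathsf{At_{nv}}$: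 $\neg p_{C,X,D}\vee[X\sqsubseteq D]$ and $\neg p_{C,X,D}\vee\neg[C\sqsubseteq D]$; (Va) for $X\in N_v$: $\neg[X>X]$; (Vb) for $X,Y,Z\in N_v$: $\neg[X>Y]\vee\neg[Y>Z]\vee[X>Z]$; (Vc) for $X,Y\in N_v$ with $\exists r.Y\in\mathsf{At}$: $\neg[X\sqsubseteq\exists r.Y]\vee[X>Y]$. -}

module Defs where

open import Data.Nat using (ℕ)
open import Data.Bool using (Bool; true; false)
open import Data.List using (List; []; _∷_; _++_; map; concatMap)
open import Data.List.Membership.Propositional using (_∈_)
open import Data.List.Relation.Unary.Any using (Any)
open import Data.Product using (_×_; _,_; Σ; ∃)
open import Relation.Binary.PropositionalEquality using (_≡_; _≢_)
open import Relation.Binary.Construct.Closure.Transitive using (TransClosure)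
open import Relation.Nullary using (¬_)

data Name : Set where
  var : ℕ → Name
  con : ℕ → Name

Role : Set
Role = ℕ

-- Flat atoms: a concept name A, or ∃r.A with A a concept name.
data FAtom : Set where
  nm : Name → FAtom
  ex : Role → Name → FAtom

V : ℕ → FAtom
V x = nm (var x)

-- A flat disunification problem: subsumptions C₁ ⊓ … ⊓ Cₙ ⊑? D (n ≥ 0)
-- and dissubsumptions X ⋢? Y between variables.
record Problem : Set where
  field
    subs : List (List FAtom × FAtom)
    diss : List (ℕ × ℕ)
open Problem public

subAtoms : FAtom → List FAtom
subAtoms (nm a)   = nm a ∷ []
subAtoms (ex r a) = ex r a ∷ nm a ∷ []

topAtoms : Problem → List FAtom
topAtoms Γ = concatMap (λ { (Cs , D) → Cs ++ (D ∷ []) }) (subs Γ)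
          ++ concatMap (λ { (x , y) → V x ∷ V y ∷ [] }) (diss Γ)

At : Problem → List FAtom
At Γ = concatMap subAtoms (topAtoms Γ)

isNonVar : FAtom → Bool
isNonVar (nm (var _)) = false
isNonVar (nm (con _)) = true
isNonVar (ex _ _)     = true

nonVars : List FAtom → List FAtom
nonVars [] = []
nonVars (C ∷ Cs) with isNonVar C
... | true  = C ∷ nonVars Cs
... | false = nonVars Cs

Atnv : Problem → List FAtom
Atnv Γ = nonVars (At Γ)

InNv : Problem → ℕ → Set
InNv Γ x = V x ∈ At Γ

InNc : Problem → ℕ → Set
InNc Γ a = nm (con a) ∈ At Γ

data PVar : Set where
  sub : FAtom → FAtom → PVar
  gt  : ℕ → ℕ → PVar
  p   : FAtom → ℕ → FAtom → PVar

data Literal : Set where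
  pos : PVar → Literal
  neg : PVar → Literal

Clause : Set
Clause = List Literal

Valuation : Set
Valuation = PVar → Bool

litTrue : Valuation → Literal → Set
litTrue τ (pos v) = τ v ≡ true
litTrue τ (neg v) = τ v ≡ false

SatClause : Valuation → Clause → Set
SatClause τ c = Any (litTrue τ) c

data Cl (Γ : Problem) : Clause → Set where
  Ia  : ∀ {Cs D} → (Cs , D) ∈ subs Γ → D ∈ Atnv Γ →
        Cl Γ (map (λ C → pos (sub C D)) Cs)
  Ib  : ∀ {Cs x E} → (Cs , V x) ∈ subs Γ → E ∈ Atnv Γ →
        Cl Γ (neg (sub (V x) E) ∷ map (λ C → pos (sub C E)) Cs)
  Ic  : ∀ {x y} → (x , y) ∈ diss Γ → Cl Γ (neg (sub (V x) (V y)) ∷ [])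
  IIa : ∀ {a} → InNc Γ a → Cl Γ (pos (sub (nm (con a)) (nm (con a))) ∷ [])
  IIb : ∀ {a b} → InNc Γ a → InNc Γ b → a ≢ b →
        Cl Γ (neg (sub (nm (con a)) (nm (con b))) ∷ [])
  IIc : ∀ {r s A B} → ex r A ∈ Atnv Γ → ex s B ∈ Atnv Γ → r ≢ s →
        Cl Γ (neg (sub (ex r A) (ex s B)) ∷ [])
  IId₁ : ∀ {a r B} → InNc Γ a → ex r B ∈ Atnv Γ →
        Cl Γ (neg (sub (nm (con a)) (ex r B)) ∷ [])
  IId₂ : ∀ {a r B} → InNc Γ a → ex r B ∈ Atnv Γ →
        Cl Γ (neg (sub (ex r B) (nm (con a))) ∷ [])
  IIe₁ : ∀ {r A B} → ex r A ∈ Atnv Γ → ex r B ∈ Atnv Γ →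
        Cl Γ (neg (sub (ex r A) (ex r B)) ∷ pos (sub (nm A) (nm B)) ∷ [])
  IIe₂ : ∀ {r A B} → ex r A ∈ Atnv Γ → ex r B ∈ Atnv Γ →
        Cl Γ (neg (sub (nm A) (nm B)) ∷ pos (sub (ex r A) (ex r B)) ∷ [])
  III : ∀ {C₁ C₂ C₃} → C₁ ∈ At Γ → C₂ ∈ At Γ → C₃ ∈ At Γ →
        Cl Γ (neg (sub C₁ C₂) ∷ neg (sub C₂ C₃) ∷ pos (sub C₁ C₃) ∷ [])
  IV₁ : ∀ {C x} → C ∈ At Γ → InNv Γ x →
        Cl Γ (pos (sub C (V x)) ∷ map (λ D → pos (p C x D)) (Atnv Γ))
  IV₂ : ∀ {C x D} → C ∈ At Γ → InNv Γ x → D ∈ Atnv Γ →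
        Cl Γ (neg (p C x D) ∷ pos (sub (V x) D) ∷ [])
  IV₃ : ∀ {C x D} → C ∈ At Γ → InNv Γ x → D ∈ Atnv Γ →
        Cl Γ (neg (p C x D) ∷ neg (sub C D) ∷ [])
  Va  : ∀ {x} → InNv Γ x → Cl Γ (neg (gt x x) ∷ [])
  Vb  : ∀ {x y z} → InNv Γ x → InNv Γ y → InNv Γ z →
        Cl Γ (neg (gt x y) ∷ neg (gt y z) ∷ pos (gt x z) ∷ [])
  Vc  : ∀ {x y r} → InNv Γ x → InNv Γ y → ex r (var y) ∈ At Γ →
        Cl Γ (neg (sub (V x) (ex r (var y))) ∷ pos (gt x y) ∷ [])

Satisfies : Valuation → Problem → Set
Satisfies τ Γ = ∀ {c} → Cl Γ c → SatClause τ c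

data OccursIn (y : ℕ) : FAtom → Set where
  here-nm : OccursIn y (nm (var y))
  here-ex : ∀ {r} → OccursIn y (ex r (var y))

InSτ : Problem → Valuation → ℕ → FAtom → Set
InSτ Γ τ x D = D ∈ Atnv Γ × τ (sub (V x) D) ≡ true

StepSτ : Problem → Valuation → ℕ → ℕ → Set
StepSτ Γ τ x y = InNv Γ x × ∃ λ D → InSτ Γ τ x D × OccursIn y D

GtSτ : Problem → Valuation → ℕ → ℕ → Set
GtSτ Γ τ = TransClosure (StepSτ Γ τ)

-- Every step X >_{S^τ} Y comes from an atom ∃r.Y ∈ S^τ_X (no variable lies in At_nv),
-- so clause (Vc) forces τ([X > Y]) = 1.  Clause (Vb) propagates this along chains,
-- hence X >_{S^τ} X would force τ([X > X]) = 1, contradicting clause (Va).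
module Submission where

open import Defs
open import Data.Nat using (ℕ)
open import Data.Bool using (true; false)
open import Data.List using (List; []; _∷_; concatMap)
open import Data.List.Membership.Propositional using (_∈_)
open import Data.List.Membership.Propositional.Properties using (∈-++⁻; ∈-++⁺ʳ)
open import Data.List.Relation.Unary.Any using (here; there)
open import Data.Product using (_×_; _,_)
open import Data.Sum using (inj₁; inj₂)
open import Relation.Binary.PropositionalEquality using (_≡_; refl; sym; trans)
open import Relation.Binary.Construct.Closure.Transitive using ([_]; _∷_)
open import Relation.Nullary using (¬_)

nonVars-⊆ : ∀ {D} (Cs : List FAtom) → D ∈ nonVars Cs → D ∈ Cs
nonVars-⊆ (C ∷ Cs) m with isNonVar C
nonVars-⊆ (C ∷ Cs) (here e)  | true  = here e
nonVars-⊆ (C ∷ Cs) (there m) | true  = there (nonVars-⊆ Cs m)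
nonVars-⊆ (C ∷ Cs) m         | false = there (nonVars-⊆ Cs m)

V∉nonVars : ∀ {y} (Cs : List FAtom) → ¬ V y ∈ nonVars Cs
V∉nonVars (C ∷ Cs) m with isNonVar C in isNonVar-C
V∉nonVars (C ∷ Cs) (here refl) | true with () ← isNonVar-C
V∉nonVars (C ∷ Cs) (there m)   | true  = V∉nonVars Cs m
V∉nonVars (C ∷ Cs) m           | false = V∉nonVars Cs m

ex∈⇒nm∈-subAtoms : ∀ {r A} (Cs : List FAtom) →
                   ex r A ∈ concatMap subAtoms Cs → nm A ∈ concatMap subAtoms Cs
ex∈⇒nm∈-subAtoms (C ∷ Cs) m with ∈-++⁻ (subAtoms C) m
ex∈⇒nm∈-subAtoms (nm B ∷ Cs)    m | inj₁ (here ())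
ex∈⇒nm∈-subAtoms (nm B ∷ Cs)    m | inj₁ (there ())
ex∈⇒nm∈-subAtoms (ex s B ∷ Cs)  m | inj₁ (here refl) = there (here refl)
ex∈⇒nm∈-subAtoms (ex s B ∷ Cs)  m | inj₁ (there (here ()))
ex∈⇒nm∈-subAtoms (ex s B ∷ Cs)  m | inj₁ (there (there ()))
ex∈⇒nm∈-subAtoms (C ∷ Cs)       m | inj₂ m′ = ∈-++⁺ʳ (subAtoms C) (ex∈⇒nm∈-subAtoms Cs m′)

resolve-neg : ∀ {τ v c} → τ v ≡ true → SatClause τ (neg v ∷ c) → SatClause τ c
resolve-neg τv (here τv≡false) with () ← trans (sym τv) τv≡false
resolve-neg τv (there sat) = sat

sat-pos-unit : ∀ {τ v} → SatClause τ (pos v ∷ []) → τ v ≡ true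
sat-pos-unit (here τv) = τv

sat-neg-unit : ∀ {τ v} → SatClause τ (neg v ∷ []) → τ v ≡ false
sat-neg-unit (here τv) = τv

module _ (Γ : Problem) (τ : Valuation) (sat : Satisfies τ Γ) where

  GtForced : ℕ → ℕ → Set
  GtForced x y = InNv Γ x × InNv Γ y × τ (gt x y) ≡ true

  StepSτ⇒GtForced : ∀ {x y} → StepSτ Γ τ x y → GtForced x y
  StepSτ⇒GtForced (_ , _ , (D∈Atnv , _) , here-nm) with () ← V∉nonVars (At Γ) D∈Atnv
  StepSτ⇒GtForced (x∈Nv , _ , (D∈Atnv , x⊑D) , here-ex) =
    x∈Nv , y∈Nv , sat-pos-unit (resolve-neg x⊑D (sat (Vc x∈Nv y∈Nv D∈At)))
    where
    D∈At = nonVars-⊆ (At Γ) D∈Atnv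
    y∈Nv = ex∈⇒nm∈-subAtoms (topAtoms Γ) D∈At

  GtSτ⇒GtForced : ∀ {x y} → GtSτ Γ τ x y → GtForced x y
  GtSτ⇒GtForced [ step ] = StepSτ⇒GtForced step
  GtSτ⇒GtForced (step ∷ chain)
    with x∈Nv , y∈Nv , x>y ← StepSτ⇒GtForced step
       | _ , z∈Nv , y>z ← GtSτ⇒GtForced chain
    = x∈Nv , z∈Nv ,
      sat-pos-unit (resolve-neg y>z (resolve-neg x>y (sat (Vb x∈Nv y∈Nv z∈Nv))))

lemma6p2 : (Γ : Problem) (τ : Valuation) → Satisfies τ Γ →
           (x : ℕ) → ¬ GtSτ Γ τ x x
lemma6p2 Γ τ sat x x>x
  with x∈Nv , _ , τx>x ← GtSτ⇒GtForced Γ τ sat x>x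
  with () ← trans (sym τx>x) (sat-neg-unit (sat (Va x∈Nv)))
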